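{- Let $s\ge 2$ and let $\mathcal P\in\mathbb Z[x_1,\ldots,x_s]$. For $\mathbf P=(P_1,\ldots,P_s)$ with $P_j\ge 1$ define \[ N_{\mathcal P}(\mathbf P)=\sum_{\substack{\mathbf x\in\mathbb Z^s\\ |x_j|\le P_j\ (1\le j\le s)}}\mu\big(|\mathcal P(\mathbf x)|\big)^2, \] and define \[ \mathfrak S_{\mathcal P}=\prod_p\left(1-\frac{\rho_{\mathcal P}(p^2)}{p^{2s}}\right),\qquad \rho_{\mathcal P}(d)=\#\{\mathbf x\in(\mathbb Z/d\mathbb Z)^s:\ \mathcal P(\mathbf x)\equiv 0 \pmod d\}. \] If $\mathfrak S_{\mathcal P}=0$, then \[ N_{\mathcal P}(\mathbf P)=o(P_1\cdots P_s)\quad\text{as }\min_jP_j\to\infty. \]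
   Context: $\mu$ is the Möbius function, extended by $\mu(0)=0$ (so $\mu(|n|)^2=1$ exactly when $n\neq 0$ is squarefree). The product over primes $p$ is defined as the limit of the partial products $\prod_{p\le n}(1-\rho_{\mathcal P}(p^2)/p^{2s})$, which form a non-negative non-increasing sequence and so converge to a non-negative limit. -}

module Defs where

open import Data.Bool using (Bool; true; false; if_then_else_; not; _∧_)
open import Data.Nat as ℕ using (ℕ; zero; suc)
open import Data.Nat.Properties using (m^n≢0)
open import Data.Nat.Divisibility using (_∣?_)
open import Data.Nat.Primality using (prime?)
open import Data.Integer as ℤ using (ℤ; +_; ∣_∣)
open import Data.Rational as ℚ using (ℚ; 1ℚ)
open import Data.List using (List; []; _∷_; map; concatMap; filter; length; upTo; foldr; _++_)
open import Data.Vec using (Vec; []; _∷_)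
open import Data.Product using (_×_; _,_; ∃)
open import Relation.Nullary using (does; ¬?)

-- A polynomial in ℤ[x₁,…,xₛ], represented as a finite list of monomials
-- (coefficient, exponent vector). Every integer polynomial has such a
-- representation; only its evaluation matters below.
Poly : ℕ → Set
Poly s = List (ℤ × Vec ℕ s)

_^ℤ_ : ℤ → ℕ → ℤ
x ^ℤ zero  = + 1
x ^ℤ suc n = x ℤ.* (x ^ℤ n)

monomial : ∀ {s} → Vec ℕ s → Vec ℤ s → ℤ
monomial []       []       = + 1
monomial (e ∷ es) (x ∷ xs) = (x ^ℤ e) ℤ.* monomial es xs

eval : ∀ {s} → Poly s → Vec ℤ s → ℤ
eval P x = foldr (λ { (c , e) acc → c ℤ.* monomial e x ℤ.+ acc }) (+ 0) P

-- n is squarefree: n ≠ 0 and no d ≥ 2 has d² ∣ n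
-- (any such d satisfies d ≤ n, so the search over 2..n is exhaustive).
allL : (ℕ → Bool) → List ℕ → Bool
allL p = foldr (λ k b → p k ∧ b) true

isSquarefree : ℕ → Bool
isSquarefree zero = false
isSquarefree n@(suc _) =
  allL (λ k → not (does (((k ℕ.+ 2) ℕ.* (k ℕ.+ 2)) ∣? n))) (upTo n)

-- μ(|n|)² as an integer: 1 if n ≠ 0 is squarefree, 0 otherwise (μ(0) = 0).
μ² : ℤ → ℕ
μ² z = if isSquarefree ∣ z ∣ then 1 else 0

interval : ℕ → List ℤ
interval P = map +_ (upTo (suc P)) ++ map (λ i → ℤ.- (+ suc i)) (upTo P)

box : ∀ {s} → Vec ℕ s → List (Vec ℤ s)
box []       = [] ∷ []
box (P ∷ Ps) = concatMap (λ a → map (a ∷_) (box Ps)) (interval P)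

N : ∀ {s} → Poly s → Vec ℕ s → ℕ
N P Ps = foldr ℕ._+_ 0 (map (λ x → μ² (eval P x)) (box Ps))

vecs : ∀ {A : Set} (s : ℕ) → List A → List (Vec A s)
vecs zero    l = [] ∷ []
vecs (suc s) l = concatMap (λ a → map (a ∷_) (vecs s l)) l

ρ : ∀ {s} → Poly s → ℕ → ℕ
ρ {s} P d = length (filter (λ x → d ∣? ∣ eval P x ∣) (vecs s (map +_ (upTo d))))

localFactor : ∀ {s} → Poly s → ℕ → ℚ
localFactor P zero = 1ℚ
localFactor {s} P (suc k) with does (prime? (suc k))
... | false = 1ℚ
... | true  = 1ℚ ℚ.- ((+ ρ P (suc k ℕ.* suc k)) ℚ./ (suc k ℕ.^ (2 ℕ.* s)))
                          {{m^n≢0 (suc k) (2 ℕ.* s)}}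

partialProd : ∀ {s} → Poly s → ℕ → ℚ
partialProd P n = foldr ℚ._*_ 1ℚ (map (localFactor P) (upTo (suc n)))

-- 𝔖_𝒫 = 0: the partial products tend to 0 (they are non-negative and
-- non-increasing, so this says the limit is 0)
SingularSeriesZero : ∀ {s} → Poly s → Set
SingularSeriesZero P = ∀ (ε : ℚ) → ℚ.0ℚ ℚ.< ε → ∃ λ n → partialProd P n ℚ.< ε

prodVec : ∀ {s} → Vec ℕ s → ℕ
prodVec []       = 1
prodVec (P ∷ Ps) = P ℕ.* prodVec Ps

AllAtLeast : ∀ {s} → ℕ → Vec ℕ s → Set
AllAtLeast M Ps = Data.Vec.Relation.Unary.All.All (M ℕ.≤_) Ps
  where import Data.Vec.Relation.Unary.All

-- μ(|𝒫(x)|)² vanishes whenever p² ∣ 𝒫(x) for some prime p, so for every n it is bounded by the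
-- indicator that p² ∤ 𝒫(x) for all primes p ≤ n. That indicator is periodic modulo m = ∏_{p ≤ n} p²,
-- hence once every P_j ≥ m its sum over the box |x_j| ≤ P_j is at most (4^s P₁⋯P_s / m^s) times its
-- sum over one period cube. By the Chinese remainder theorem the period sum factors into the local
-- counts p^{2s} − ρ(p²), i.e. it equals m^s ∏_{p ≤ n} (1 − ρ(p²)/p^{2s}). Thus
-- N(𝐏) ≤ 4^s P₁⋯P_s ∏_{p ≤ n} (1 − ρ(p²)/p^{2s}), and the partial products tend to 0.

module Submission where

import Algebra.Properties.CommutativeMonoid.Sum as CommutativeMonoidSum
open import Data.Bool using (Bool; true; false; if_then_else_; not; _∧_)
open import Data.Bool.Properties using (∧-zeroʳ)
open import Data.Empty using (⊥-elim)
open import Data.Fin using (Fin; toℕ; fromℕ<)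
import Data.Fin.Properties as Finₚ
open import Data.Fin.Permutation using (Permutation′; permutation; _⟨$⟩ʳ_)
open import Data.Integer as ℤ using (ℤ; +_; -[1+_]; ∣_∣)
  renaming (_+_ to _+ᶻ_; _*_ to _*ᶻ_; -_ to -ᶻ_; _-_ to _-ᶻ_)
import Data.Integer.Properties as ℤₚ
open import Data.Integer.DivMod using (_%ℕ_; _/ℕ_; n%ℕd<d; a≡a%ℕn+[a/ℕn]*n)
import Data.Integer.Divisibility.Signed as ℤ∣
open import Data.Integer.Tactic.RingSolver using (solve-∀)
open import Data.List using (List; []; _∷_; map; foldr; _++_; concatMap; applyUpTo; upTo; filter; length)
import Data.List.Properties as Listₚ
open import Data.List.Relation.Unary.All using (All; []; _∷_)
open import Data.List.Relation.Unary.AllPairs using (AllPairs; []; _∷_)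
import Data.List.Relation.Unary.AllPairs.Properties as AllPairs
open import Data.List.Relation.Unary.Any using (Any; here; there)
open import Data.List.Relation.Unary.Any.Properties using (applyUpTo⁺)
open import Data.Nat as ℕ using (ℕ; zero; suc; _+_; _*_; _^_; _∸_; _/_; _≤_; _<_; z≤n; s≤s; NonZero)
import Data.Nat.Properties as ℕₚ
import Data.Nat.DivMod as ℕ/
open import Data.Nat.Coprimality as Coprimality using (Coprime; coprime-Bézout; prime⇒coprime)
open import Data.Nat.Divisibility using (_∣_; _∣?_; ∣⇒≤)
open import Data.Nat.GCD using (module Bézout)
open import Data.Nat.ListAction using (product)
open import Data.Nat.Primality using (prime?; prime⇒nonZero; prime⇒nonTrivial; ¬prime[0])
import Data.Nat.Tactic.RingSolver as ℕ-Solver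
open import Data.Product using (∃; _,_)
open import Data.Rational as ℚ using (ℚ; 0ℚ; 1ℚ)
import Data.Rational.Properties as ℚₚ
open import Data.Rational.Solver using (module +-*-Solver)
open import Data.Rational.Unnormalised as ℚᵘ using (mkℚᵘ; *≡*; *≤*)
import Data.Rational.Unnormalised.Properties as ℚᵘₚ
open import Data.Vec using (Vec; []; _∷_; replicate)
open import Data.Vec.Relation.Binary.Pointwise.Inductive as Pointwise using (Pointwise; []; _∷_)
import Data.Vec.Relation.Unary.All as Vec
open import Function using (_∘_)
open import Function.Bundles using (mk⇔)
open import Level using (0ℓ)
open import Relation.Binary.Bundles using (Setoid)
open import Relation.Binary.PropositionalEquality
import Relation.Binary.Reasoning.Setoid as SetoidReasoning
open import Relation.Nullary using (does; yes; no)
open import Relation.Nullary.Decidable using (does-⇔; dec-true)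
open import Relation.Unary using (Decidable)

open import Defs

^-distribʳ-* : ∀ s x y → (x * y) ^ s ≡ x ^ s * y ^ s
^-distribʳ-* zero    x y = refl
^-distribʳ-* (suc s) x y = trans (cong (x * y *_) (^-distribʳ-* s x y)) (lemma x y (x ^ s) (y ^ s))
  where lemma : ∀ x y a b → x * y * (a * b) ≡ x * a * (y * b)
        lemma = ℕ-Solver.solve-∀

≤1⇒≤* : ∀ {b c d} → b ≤ 1 → b ≤ c → b ≤ d → b ≤ c * d
≤1⇒≤* {zero}        _         _   _   = z≤n
≤1⇒≤* {suc zero}    _         1≤c 1≤d = ℕₚ.*-mono-≤ 1≤c 1≤d
≤1⇒≤* {suc (suc _)} (s≤s ()) _   _

sumTo : ℕ → (ℕ → ℕ) → ℕ
sumTo zero    f = 0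
sumTo (suc n) f = f 0 + sumTo n (λ i → f (suc i))

sumTo-cong-< : ∀ n {f g : ℕ → ℕ} → (∀ i → i < n → f i ≡ g i) → sumTo n f ≡ sumTo n g
sumTo-cong-< zero    eq = refl
sumTo-cong-< (suc n) eq = cong₂ _+_ (eq 0 (s≤s z≤n)) (sumTo-cong-< n (λ i i<n → eq (suc i) (s≤s i<n)))

sumTo-cong : ∀ n {f g : ℕ → ℕ} → (∀ i → f i ≡ g i) → sumTo n f ≡ sumTo n g
sumTo-cong n eq = sumTo-cong-< n (λ i _ → eq i)

sumTo-mono : ∀ n {f g : ℕ → ℕ} → (∀ i → f i ≤ g i) → sumTo n f ≤ sumTo n g
sumTo-mono zero    le = z≤n
sumTo-mono (suc n) le = ℕₚ.+-mono-≤ (le 0) (sumTo-mono n (λ i → le (suc i)))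

sumTo-snoc : ∀ n f → sumTo (suc n) f ≡ sumTo n f + f n
sumTo-snoc zero    f = ℕₚ.+-comm (f 0) 0
sumTo-snoc (suc n) f =
  trans (cong (_+_ (f 0)) (sumTo-snoc n (λ i → f (suc i)))) (sym (ℕₚ.+-assoc (f 0) _ _))

sumTo-split : ∀ a b f → sumTo (a + b) f ≡ sumTo a f + sumTo b (λ i → f (a + i))
sumTo-split zero    b f = refl
sumTo-split (suc a) b f =
  trans (cong (_+_ (f 0)) (sumTo-split a b (λ i → f (suc i)))) (sym (ℕₚ.+-assoc (f 0) _ _))

sumTo-mono-length : ∀ {a b} f → a ≤ b → sumTo a f ≤ sumTo b f
sumTo-mono-length {a} f a≤b with ℕₚ.m≤n⇒∃[o]m+o≡n a≤b
... | c , refl = subst (sumTo a f ≤_) (sym (sumTo-split a c f)) (ℕₚ.m≤m+n _ _)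

sumTo-distribˡ : ∀ n c f → sumTo n (λ i → c * f i) ≡ c * sumTo n f
sumTo-distribˡ zero    c f = sym (ℕₚ.*-zeroʳ c)
sumTo-distribˡ (suc n) c f = trans (cong (_+_ (c * f 0)) (sumTo-distribˡ n c (λ i → f (suc i))))
  (sym (ℕₚ.*-distribˡ-+ c (f 0) _))

sumTo-distrib-+ : ∀ n f g → sumTo n (λ i → f i + g i) ≡ sumTo n f + sumTo n g
sumTo-distrib-+ zero    f g = refl
sumTo-distrib-+ (suc n) f g =
  trans (cong (_+_ (f 0 + g 0)) (sumTo-distrib-+ n (λ i → f (suc i)) (λ i → g (suc i))))
        (interchange (f 0) (g 0) _ _)
  where
  interchange : ∀ a b c d → a + b + (c + d) ≡ a + c + (b + d)
  interchange = ℕ-Solver.solve-∀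

sumTo-zero : ∀ n → sumTo n (λ _ → 0) ≡ 0
sumTo-zero zero    = refl
sumTo-zero (suc n) = sumTo-zero n

sumTo-comm : ∀ n m (f : ℕ → ℕ → ℕ) →
  sumTo n (λ i → sumTo m (λ j → f i j)) ≡ sumTo m (λ j → sumTo n (λ i → f i j))
sumTo-comm zero    m f = sym (sumTo-zero m)
sumTo-comm (suc n) m f =
  trans (cong (_+_ (sumTo m (f 0))) (sumTo-comm n m (λ i → f (suc i))))
        (sym (sumTo-distrib-+ m (f 0) (λ j → sumTo n (λ i → f (suc i) j))))

sumTo-reverse : ∀ n f → sumTo n (λ i → f (n ∸ suc i)) ≡ sumTo n f
sumTo-reverse zero    f = refl
sumTo-reverse (suc n) f = begin
  f n + sumTo n (λ i → f (n ∸ suc i)) ≡⟨ cong (_+_ (f n)) (sumTo-reverse n f) ⟩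
  f n + sumTo n f                     ≡⟨ ℕₚ.+-comm (f n) _ ⟩
  sumTo n f + f n                     ≡⟨ sym (sumTo-snoc n f) ⟩
  sumTo (suc n) f                     ∎
  where open ≡-Reasoning

sumTo-periodic : ∀ k m f → (∀ i → f (i + m) ≡ f i) → sumTo (k * m) f ≡ k * sumTo m f
sumTo-periodic zero    m f per = refl
sumTo-periodic (suc k) m f per = begin
  sumTo (m + k * m) f                            ≡⟨ sumTo-split m (k * m) f ⟩
  sumTo m f + sumTo (k * m) (λ i → f (m + i))    ≡⟨ cong (_+_ (sumTo m f)) (sumTo-cong (k * m) shifted) ⟩
  sumTo m f + sumTo (k * m) f                    ≡⟨ cong (_+_ (sumTo m f)) (sumTo-periodic k m f per) ⟩
  sumTo m f + k * sumTo m f                      ∎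
  where
  open ≡-Reasoning
  shifted : ∀ i → f (m + i) ≡ f i
  shifted i = trans (cong f (ℕₚ.+-comm m i)) (per i)

sumTo-blocks : ∀ n m f → sumTo (n * m) f ≡ sumTo n (λ t → sumTo m (λ u → f (t * m + u)))
sumTo-blocks zero    m f = refl
sumTo-blocks (suc n) m f = begin
  sumTo (m + n * m) f                                         ≡⟨ sumTo-split m (n * m) f ⟩
  sumTo m f + sumTo (n * m) (λ i → f (m + i))                 ≡⟨ cong (_+_ (sumTo m f)) (sumTo-blocks n m _) ⟩
  sumTo m f + sumTo n (λ t → sumTo m (λ u → f (m + (t * m + u))))
    ≡⟨ cong (_+_ (sumTo m f)) (sumTo-cong n λ t → sumTo-cong m λ u →
         cong f (sym (ℕₚ.+-assoc m (t * m) u))) ⟩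
  sumTo m f + sumTo n (λ t → sumTo m (λ u → f (suc t * m + u))) ∎
  where open ≡-Reasoning

sumOver : ∀ {A : Set} → List A → (A → ℕ) → ℕ
sumOver l f = foldr _+_ 0 (map f l)

sumOver-++ : ∀ {A : Set} (xs ys : List A) f → sumOver (xs ++ ys) f ≡ sumOver xs f + sumOver ys f
sumOver-++ []       ys f = refl
sumOver-++ (x ∷ xs) ys f = trans (cong (_+_ (f x)) (sumOver-++ xs ys f)) (sym (ℕₚ.+-assoc (f x) _ _))

sumOver-map : ∀ {A B : Set} (g : A → B) l f → sumOver (map g l) f ≡ sumOver l (f ∘ g)
sumOver-map g []      f = refl
sumOver-map g (x ∷ l) f = cong (_+_ (f (g x))) (sumOver-map g l f)

sumOver-applyUpTo : ∀ {A : Set} n (g : ℕ → A) f → sumOver (applyUpTo g n) f ≡ sumTo n (f ∘ g)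
sumOver-applyUpTo zero    g f = refl
sumOver-applyUpTo (suc n) g f = cong (_+_ (f (g 0))) (sumOver-applyUpTo n (g ∘ suc) f)

sumOver-mono : ∀ {A : Set} (l : List A) {f g} → (∀ a → f a ≤ g a) → sumOver l f ≤ sumOver l g
sumOver-mono []      le = z≤n
sumOver-mono (x ∷ l) le = ℕₚ.+-mono-≤ (le x) (sumOver-mono l le)

sumOver-cong : ∀ {A : Set} (l : List A) {f g} → (∀ a → f a ≡ g a) → sumOver l f ≡ sumOver l g
sumOver-cong []      eq = refl
sumOver-cong (x ∷ l) eq = cong₂ _+_ (eq x) (sumOver-cong l eq)

sumOver-distribˡ : ∀ {A : Set} (l : List A) c f → sumOver l (λ a → c * f a) ≡ c * sumOver l f
sumOver-distribˡ []      c f = sym (ℕₚ.*-zeroʳ c)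
sumOver-distribˡ (x ∷ l) c f =
  trans (cong (_+_ (c * f x)) (sumOver-distribˡ l c f)) (sym (ℕₚ.*-distribˡ-+ c (f x) _))

sumOver-grid : ∀ {s} (l : List ℤ) (vs : List (Vec ℤ s)) F →
  sumOver (concatMap (λ a → map (a ∷_) vs) l) F ≡ sumOver l (λ a → sumOver vs (λ v → F (a ∷ v)))
sumOver-grid []      vs F = refl
sumOver-grid (a ∷ l) vs F = trans (sumOver-++ (map (a ∷_) vs) _ F)
  (cong₂ _+_ (sumOver-map (a ∷_) vs F) (sumOver-grid l vs F))

length-grid : ∀ {s} (l : List ℤ) (vs : List (Vec ℤ s)) →
  length (concatMap (λ a → map (a ∷_) vs) l) ≡ length l * length vs
length-grid []      vs = refl
length-grid (a ∷ l) vs = trans (Listₚ.length-++ (map (a ∷_) vs))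
  (cong₂ _+_ (Listₚ.length-map (a ∷_) vs) (length-grid l vs))

length-vecs : ∀ s (l : List ℤ) → length (vecs s l) ≡ length l ^ s
length-vecs zero    l = refl
length-vecs (suc s) l = trans (length-grid l (vecs s l)) (cong (length l *_) (length-vecs s l))

sumOver-rejected+length-filter : ∀ {A : Set} {Q : A → Set} (Q? : Decidable Q) l →
  sumOver l (λ x → if does (Q? x) then 0 else 1) + length (filter Q? l) ≡ length l
sumOver-rejected+length-filter Q? []      = refl
sumOver-rejected+length-filter Q? (x ∷ l) with does (Q? x)
... | true  = trans (ℕₚ.+-suc _ _) (cong suc (sumOver-rejected+length-filter Q? l))
... | false = cong suc (sumOver-rejected+length-filter Q? l)

-- Congruences and periodic functions

infix 4 _≡_[mod_] _≋_[mod_]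

record _≡_[mod_] (a b : ℤ) (n : ℕ) : Set where
  constructor mod-by
  field
    quotient : ℤ
    equation : a ≡ b +ᶻ quotient *ᶻ + n

mod-refl : ∀ {n} a → a ≡ a [mod n ]
mod-refl {n} a = mod-by (+ 0) (lemma a (+ n))
  where lemma : ∀ a n → a ≡ a +ᶻ + 0 *ᶻ n
        lemma = solve-∀

mod-reflexive : ∀ {n a b} → a ≡ b → a ≡ b [mod n ]
mod-reflexive {a = a} refl = mod-refl a

mod-sym : ∀ {n a b} → a ≡ b [mod n ] → b ≡ a [mod n ]
mod-sym {n} {b = b} (mod-by k refl) = mod-by (-ᶻ k) (lemma b k (+ n))
  where lemma : ∀ b k n → b ≡ b +ᶻ k *ᶻ n +ᶻ (-ᶻ k) *ᶻ n
        lemma = solve-∀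

mod-trans : ∀ {n a b c} → a ≡ b [mod n ] → b ≡ c [mod n ] → a ≡ c [mod n ]
mod-trans {n} {c = c} (mod-by k refl) (mod-by l refl) = mod-by (l +ᶻ k) (lemma c k l (+ n))
  where lemma : ∀ c k l n → c +ᶻ l *ᶻ n +ᶻ k *ᶻ n ≡ c +ᶻ (l +ᶻ k) *ᶻ n
        lemma = solve-∀

mod-+ : ∀ {n a b c d} → a ≡ b [mod n ] → c ≡ d [mod n ] → a +ᶻ c ≡ b +ᶻ d [mod n ]
mod-+ {n} {b = b} {d = d} (mod-by k refl) (mod-by l refl) = mod-by (k +ᶻ l) (lemma b d k l (+ n))
  where lemma : ∀ b d k l n → b +ᶻ k *ᶻ n +ᶻ (d +ᶻ l *ᶻ n) ≡ b +ᶻ d +ᶻ (k +ᶻ l) *ᶻ n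
        lemma = solve-∀

mod-* : ∀ {n a b c d} → a ≡ b [mod n ] → c ≡ d [mod n ] → a *ᶻ c ≡ b *ᶻ d [mod n ]
mod-* {n} {b = b} {d = d} (mod-by k refl) (mod-by l refl) =
  mod-by (k *ᶻ d +ᶻ b *ᶻ l +ᶻ k *ᶻ l *ᶻ + n) (lemma b d k l (+ n))
  where lemma : ∀ b d k l n → (b +ᶻ k *ᶻ n) *ᶻ (d +ᶻ l *ᶻ n) ≡
                              b *ᶻ d +ᶻ (k *ᶻ d +ᶻ b *ᶻ l +ᶻ k *ᶻ l *ᶻ n) *ᶻ n
        lemma = solve-∀

mod-factorʳ : ∀ {m n a b} → a ≡ b [mod m * n ] → a ≡ b [mod n ]
mod-factorʳ {m} {n} {b = b} (mod-by k refl) =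
  mod-by (k *ᶻ + m) (trans (cong (λ z → b +ᶻ k *ᶻ z) (ℤₚ.pos-* m n)) (lemma b k (+ m) (+ n)))
  where lemma : ∀ b k m n → b +ᶻ k *ᶻ (m *ᶻ n) ≡ b +ᶻ k *ᶻ m *ᶻ n
        lemma = solve-∀

mod-factorˡ : ∀ {m n a b} → a ≡ b [mod m * n ] → a ≡ b [mod m ]
mod-factorˡ {m} {n} {a} {b} eq = mod-factorʳ {n} (subst (a ≡ b [mod_]) (ℕₚ.*-comm m n) eq)

mod-%ℕ : ∀ n .{{_ : NonZero n}} a → a ≡ + (a %ℕ n) [mod n ]
mod-%ℕ n a = mod-by (a /ℕ n) (a≡a%ℕn+[a/ℕn]*n a n)

mod-<-unique⁺ : ∀ {n r r′} j → r < n → + r ≡ + r′ +ᶻ + j *ᶻ + n → r ≡ r′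
mod-<-unique⁺ {n} {r} {r′} j r<n eq
  with ℤₚ.+-injective (trans eq (sym (trans (ℤₚ.pos-+ r′ (j * n))
                                            (cong (_+ᶻ_ (+ r′)) (ℤₚ.pos-* j n)))))
... | r≡r′+jn with j
...   | zero   = trans r≡r′+jn (ℕₚ.+-identityʳ r′)
...   | suc j′ = ⊥-elim (ℕₚ.<⇒≱ r<n (subst (n ≤_) (sym r≡r′+jn)
                   (ℕₚ.≤-trans (ℕₚ.m≤m+n n (j′ * n)) (ℕₚ.m≤n+m (n + j′ * n) r′))))

mod-<-unique : ∀ {n r r′} → r < n → r′ < n → + r ≡ + r′ [mod n ] → r ≡ r′
mod-<-unique r<n r′<n (mod-by (+ j) eq)       = mod-<-unique⁺ j r<n eq
mod-<-unique {n} {r} {r′} r<n r′<n (mod-by -[1+ j ] eq) =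
  sym (mod-<-unique⁺ (suc j) r′<n
        (trans (lemma (+ r′) (+ suc j) (+ n)) (cong (λ z → z +ᶻ + suc j *ᶻ + n) (sym eq))))
  where lemma : ∀ r k n → r ≡ r +ᶻ (-ᶻ k) *ᶻ n +ᶻ k *ᶻ n
        lemma = solve-∀

mod-setoid : ℕ → Setoid 0ℓ 0ℓ
mod-setoid n = record
  { Carrier       = ℤ
  ; _≈_           = _≡_[mod n ]
  ; isEquivalence = record { refl = mod-refl _ ; sym = mod-sym ; trans = mod-trans }
  }

module ModReasoning (n : ℕ) = SetoidReasoning (mod-setoid n)

_≋_[mod_] : ∀ {s} → Vec ℤ s → Vec ℤ s → ℕ → Set
x ≋ y [mod n ] = Pointwise (λ a b → a ≡ b [mod n ]) x y

≋-refl : ∀ {s n} (x : Vec ℤ s) → x ≋ x [mod n ]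
≋-refl x = Pointwise.refl (mod-refl _)

Periodic₁ : ℕ → (ℤ → ℕ) → Set
Periodic₁ n φ = ∀ {a b} → a ≡ b [mod n ] → φ a ≡ φ b

Periodic : ∀ {s} → ℕ → (Vec ℤ s → ℕ) → Set
Periodic n F = ∀ {x y} → x ≋ y [mod n ] → F x ≡ F y

periodic-multipleˡ : ∀ {s m n} {F : Vec ℤ s → ℕ} → Periodic n F → Periodic (m * n) F
periodic-multipleˡ {m = m} per eq = per (Pointwise.map (mod-factorʳ {m}) eq)

periodic-multipleʳ : ∀ {s m n} {F : Vec ℤ s → ℕ} → Periodic m F → Periodic (m * n) F
periodic-multipleʳ {m = m} per eq = per (Pointwise.map (mod-factorˡ {m}) eq)

periodic-fixHead : ∀ {s n} {F : Vec ℤ (suc s) → ℕ} a → Periodic n F → Periodic n (λ v → F (a ∷ v))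
periodic-fixHead a per eq = per (mod-refl a ∷ eq)

sumBox : ∀ {s} → Vec ℕ s → (Vec ℤ s → ℕ) → ℕ
sumBox []       F = F []
sumBox (L ∷ Ls) F = sumTo L (λ i → sumBox Ls (λ v → F (+ i ∷ v)))

sumCube : (s : ℕ) → ℕ → (Vec ℤ s → ℕ) → ℕ
sumCube s m = sumBox (replicate s m)

sumBox-cong : ∀ {s} (Ls : Vec ℕ s) {F G} → (∀ v → F v ≡ G v) → sumBox Ls F ≡ sumBox Ls G
sumBox-cong []       eq = eq []
sumBox-cong (L ∷ Ls) eq = sumTo-cong L (λ i → sumBox-cong Ls (λ v → eq (+ i ∷ v)))

sumCube-cong : ∀ s m {F G} → (∀ v → F v ≡ G v) → sumCube s m F ≡ sumCube s m G
sumCube-cong s m = sumBox-cong (replicate s m)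

sumBox-distribˡ : ∀ {s} (Ls : Vec ℕ s) c F → sumBox Ls (λ v → c * F v) ≡ c * sumBox Ls F
sumBox-distribˡ []       c F = refl
sumBox-distribˡ (L ∷ Ls) c F =
  trans (sumTo-cong L (λ i → sumBox-distribˡ Ls c (λ v → F (+ i ∷ v)))) (sumTo-distribˡ L c _)

sumBox-comm : ∀ {s} (Ls : Vec ℕ s) n (G : ℕ → Vec ℤ s → ℕ) →
  sumTo n (λ t → sumBox Ls (G t)) ≡ sumBox Ls (λ v → sumTo n (λ t → G t v))
sumBox-comm []       n G = refl
sumBox-comm (L ∷ Ls) n G = trans (sumTo-comm n L _)
  (sumTo-cong L (λ i → sumBox-comm Ls n (λ t v → G t (+ i ∷ v))))

sumBox-periodicʰ : ∀ {s n} (Ls : Vec ℕ s) {F : Vec ℤ (suc s) → ℕ} → Periodic n F →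
  Periodic₁ n (λ a → sumBox Ls (λ v → F (a ∷ v)))
sumBox-periodicʰ Ls per eq = sumBox-cong Ls (λ v → per (eq ∷ ≋-refl v))

sumCube-one : ∀ s c → sumCube s 1 (λ _ → c) ≡ c
sumCube-one zero    c = refl
sumCube-one (suc s) c = trans (ℕₚ.+-identityʳ _) (sumCube-one s c)

-- Units modulo n and the Chinese remainder theorem

record UnitMod (m n : ℕ) : Set where
  constructor _,_
  field
    inverse   : ℤ
    isInverse : + m *ᶻ inverse ≡ + 1 [mod n ]

unitMod-one : ∀ n → UnitMod 1 n
unitMod-one n = + 1 , mod-refl (+ 1)

unitMod-modOne : ∀ m → UnitMod m 1
unitMod-modOne m = + 0 , mod-by (-ᶻ + 1) (lemma (+ m))
  where lemma : ∀ m → m *ᶻ + 0 ≡ + 1 +ᶻ (-ᶻ + 1) *ᶻ + 1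
        lemma = solve-∀

unitMod-* : ∀ {m₁ m₂ n} → UnitMod m₁ n → UnitMod m₂ n → UnitMod (m₁ * m₂) n
unitMod-* {m₁} {m₂} (a , u₁) (b , u₂) =
  a *ᶻ b , subst (λ z → z *ᶻ (a *ᶻ b) ≡ + 1 [mod _ ]) (sym (ℤₚ.pos-* m₁ m₂))
    (mod-trans (mod-reflexive (lemma (+ m₁) (+ m₂) a b)) (mod-* u₁ u₂))
  where lemma : ∀ m₁ m₂ a b → m₁ *ᶻ m₂ *ᶻ (a *ᶻ b) ≡ (m₁ *ᶻ a) *ᶻ (m₂ *ᶻ b)
        lemma = solve-∀

-- If m a ≡ 1 (mod n₁) and m b ≡ 1 (mod n₂) then 1 − m(a + b − m a b) = (1 − m a)(1 − m b) ≡ 0 (mod n₁ n₂).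
unitMod-*-modulus : ∀ {m n₁ n₂} → UnitMod m n₁ → UnitMod m n₂ → UnitMod m (n₁ * n₂)
unitMod-*-modulus {m} {n₁} {n₂} (a , mod-by k₁ eq₁) (b , mod-by k₂ eq₂) =
  a +ᶻ b -ᶻ + m *ᶻ a *ᶻ b ,
  mod-by (-ᶻ (k₁ *ᶻ k₂)) (begin
    + m *ᶻ (a +ᶻ b -ᶻ + m *ᶻ a *ᶻ b)                          ≡⟨ expand (+ m) a b ⟩
    + m *ᶻ a +ᶻ + m *ᶻ b -ᶻ (+ m *ᶻ a) *ᶻ (+ m *ᶻ b)          ≡⟨ cong₂ (λ x y → x +ᶻ y -ᶻ x *ᶻ y) eq₁ eq₂ ⟩
    one+ k₁ (+ n₁) +ᶻ one+ k₂ (+ n₂) -ᶻ one+ k₁ (+ n₁) *ᶻ one+ k₂ (+ n₂)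
                                                              ≡⟨ collect k₁ k₂ (+ n₁) (+ n₂) ⟩
    + 1 +ᶻ (-ᶻ (k₁ *ᶻ k₂)) *ᶻ (+ n₁ *ᶻ + n₂)                  ≡⟨ cong (λ z → + 1 +ᶻ (-ᶻ (k₁ *ᶻ k₂)) *ᶻ z) (sym (ℤₚ.pos-* n₁ n₂)) ⟩
    + 1 +ᶻ (-ᶻ (k₁ *ᶻ k₂)) *ᶻ + (n₁ * n₂)                     ∎)
  where
  open ≡-Reasoning
  one+ : ℤ → ℤ → ℤ
  one+ k n = + 1 +ᶻ k *ᶻ n
  expand : ∀ m a b → m *ᶻ (a +ᶻ b -ᶻ m *ᶻ a *ᶻ b) ≡ m *ᶻ a +ᶻ m *ᶻ b -ᶻ (m *ᶻ a) *ᶻ (m *ᶻ b)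
  expand = solve-∀
  collect : ∀ k₁ k₂ n₁ n₂ → + 1 +ᶻ k₁ *ᶻ n₁ +ᶻ (+ 1 +ᶻ k₂ *ᶻ n₂) -ᶻ (+ 1 +ᶻ k₁ *ᶻ n₁) *ᶻ (+ 1 +ᶻ k₂ *ᶻ n₂)
                              ≡ + 1 +ᶻ (-ᶻ (k₁ *ᶻ k₂)) *ᶻ (n₁ *ᶻ n₂)
  collect = solve-∀

bézout⇒unitMod : ∀ {m n} → Bézout.Identity 1 n m → UnitMod m n
bézout⇒unitMod {m} {n} (Bézout.+- x y eq) = -ᶻ + y , mod-by (-ᶻ + x) (begin
  + m *ᶻ (-ᶻ + y)               ≡⟨ lemma₁ (+ m) (+ y) ⟩
  + 1 -ᶻ (+ 1 +ᶻ + y *ᶻ + m)    ≡⟨ cong (_-ᶻ_ (+ 1)) (trans (sym (pos-1+* y m)) (trans (cong +_ eq) (ℤₚ.pos-* x n))) ⟩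
  + 1 -ᶻ + x *ᶻ + n             ≡⟨ lemma₂ (+ x) (+ n) ⟩
  + 1 +ᶻ (-ᶻ + x) *ᶻ + n        ∎)
  where
  open ≡-Reasoning
  pos-1+* : ∀ a b → + (1 + a * b) ≡ + 1 +ᶻ + a *ᶻ + b
  pos-1+* a b = trans (ℤₚ.pos-+ 1 (a * b)) (cong (_+ᶻ_ (+ 1)) (ℤₚ.pos-* a b))
  lemma₁ : ∀ m y → m *ᶻ (-ᶻ y) ≡ + 1 -ᶻ (+ 1 +ᶻ y *ᶻ m)
  lemma₁ = solve-∀
  lemma₂ : ∀ x n → + 1 -ᶻ x *ᶻ n ≡ + 1 +ᶻ (-ᶻ x) *ᶻ n
  lemma₂ = solve-∀
bézout⇒unitMod {m} {n} (Bézout.-+ x y eq) = + y , mod-by (+ x) (begin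
  + m *ᶻ + y          ≡⟨ sym (ℤₚ.pos-* m y) ⟩
  + (m * y)           ≡⟨ cong +_ (trans (ℕₚ.*-comm m y) (sym eq)) ⟩
  + (1 + x * n)       ≡⟨ trans (ℤₚ.pos-+ 1 (x * n)) (cong (_+ᶻ_ (+ 1)) (ℤₚ.pos-* x n)) ⟩
  + 1 +ᶻ + x *ᶻ + n   ∎)
  where open ≡-Reasoning

coprime⇒unitMod : ∀ {m n} → Coprime n m → UnitMod m n
coprime⇒unitMod = bézout⇒unitMod ∘ coprime-Bézout

module AffinePermutation (m n : ℕ) .{{_ : NonZero n}} (unit : UnitMod m n) (u : ℤ) where

  open UnitMod unit renaming (inverse to m⁻¹)

  affine : ℕ → ℕ
  affine i = (u +ᶻ + m *ᶻ + i) %ℕ n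

  affine⁻¹ : ℕ → ℕ
  affine⁻¹ r = ((+ r -ᶻ u) *ᶻ m⁻¹) %ℕ n

  affine∘affine⁻¹ : ∀ r → r < n → affine (affine⁻¹ r) ≡ r
  affine∘affine⁻¹ r r<n = mod-<-unique (n%ℕd<d (u +ᶻ + m *ᶻ + affine⁻¹ r) n) r<n (begin
    + affine (affine⁻¹ r)                ≈⟨ mod-sym (mod-%ℕ n _) ⟩
    u +ᶻ + m *ᶻ + affine⁻¹ r             ≈⟨ mod-+ (mod-refl u) (mod-* (mod-refl (+ m)) (mod-sym (mod-%ℕ n ((+ r -ᶻ u) *ᶻ m⁻¹)))) ⟩
    u +ᶻ + m *ᶻ ((+ r -ᶻ u) *ᶻ m⁻¹)      ≡⟨ regroup u (+ m) (+ r) m⁻¹ ⟩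
    u +ᶻ (+ r -ᶻ u) *ᶻ (+ m *ᶻ m⁻¹)      ≈⟨ mod-+ (mod-refl u) (mod-* (mod-refl (+ r -ᶻ u)) isInverse) ⟩
    u +ᶻ (+ r -ᶻ u) *ᶻ + 1               ≡⟨ cancel u (+ r) ⟩
    + r                                  ∎)
    where
    open ModReasoning n
    regroup : ∀ u m r m⁻¹ → u +ᶻ m *ᶻ ((r -ᶻ u) *ᶻ m⁻¹) ≡ u +ᶻ (r -ᶻ u) *ᶻ (m *ᶻ m⁻¹)
    regroup = solve-∀
    cancel : ∀ u r → u +ᶻ (r -ᶻ u) *ᶻ + 1 ≡ r
    cancel = solve-∀

  affine⁻¹∘affine : ∀ i → i < n → affine⁻¹ (affine i) ≡ i
  affine⁻¹∘affine i i<n = mod-<-unique (n%ℕd<d ((+ affine i -ᶻ u) *ᶻ m⁻¹) n) i<n (begin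
    + affine⁻¹ (affine i)                ≈⟨ mod-sym (mod-%ℕ n _) ⟩
    (+ affine i -ᶻ u) *ᶻ m⁻¹             ≈⟨ mod-* (mod-+ (mod-sym (mod-%ℕ n (u +ᶻ + m *ᶻ + i))) (mod-refl (-ᶻ u))) (mod-refl m⁻¹) ⟩
    (u +ᶻ + m *ᶻ + i -ᶻ u) *ᶻ m⁻¹        ≡⟨ regroup u (+ m) (+ i) m⁻¹ ⟩
    + i *ᶻ (+ m *ᶻ m⁻¹)                  ≈⟨ mod-* (mod-refl (+ i)) isInverse ⟩
    + i *ᶻ + 1                           ≡⟨ ℤₚ.*-identityʳ (+ i) ⟩
    + i                                  ∎)
    where
    open ModReasoning n
    regroup : ∀ u m i m⁻¹ → (u +ᶻ m *ᶻ i -ᶻ u) *ᶻ m⁻¹ ≡ i *ᶻ (m *ᶻ m⁻¹)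
    regroup = solve-∀

  affineᶠ : Fin n → Fin n
  affineᶠ i = fromℕ< (n%ℕd<d (u +ᶻ + m *ᶻ + toℕ i) n)

  affine⁻¹ᶠ : Fin n → Fin n
  affine⁻¹ᶠ r = fromℕ< (n%ℕd<d ((+ toℕ r -ᶻ u) *ᶻ m⁻¹) n)

  toℕ-affineᶠ : ∀ i → toℕ (affineᶠ i) ≡ affine (toℕ i)
  toℕ-affineᶠ i = Finₚ.toℕ-fromℕ< _

  affineᶠ-permutation : Permutation′ n
  affineᶠ-permutation = permutation affineᶠ affine⁻¹ᶠ
    (λ r → Finₚ.toℕ-injective (trans (Finₚ.toℕ-fromℕ< _)
      (trans (cong affine (Finₚ.toℕ-fromℕ< _)) (affine∘affine⁻¹ (toℕ r) (Finₚ.toℕ<n r)))))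
    (λ i → Finₚ.toℕ-injective (trans (Finₚ.toℕ-fromℕ< _)
      (trans (cong affine⁻¹ (Finₚ.toℕ-fromℕ< _)) (affine⁻¹∘affine (toℕ i) (Finₚ.toℕ<n i)))))

module ℕ-Sum = CommutativeMonoidSum ℕₚ.+-0-commutativeMonoid

sumTo≡∑ : ∀ n (f : ℕ → ℕ) → sumTo n f ≡ ℕ-Sum.∑[ i < n ] f (toℕ i)
sumTo≡∑ zero    f = refl
sumTo≡∑ (suc n) f = cong (_+_ (f 0)) (sumTo≡∑ n (λ i → f (suc i)))

sumTo-affine : ∀ m n .{{_ : NonZero n}} → UnitMod m n → ∀ {ψ} → Periodic₁ n ψ → ∀ u →
  sumTo n (λ i → ψ (u +ᶻ + m *ᶻ + i)) ≡ sumTo n (λ i → ψ (+ i))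
sumTo-affine m n unit {ψ} per u = begin
  sumTo n (λ i → ψ (u +ᶻ + m *ᶻ + i))           ≡⟨ sumTo-cong n (λ i → per (mod-%ℕ n _)) ⟩
  sumTo n (λ i → ψ (+ affine i))                ≡⟨ sumTo≡∑ n _ ⟩
  ℕ-Sum.∑[ i < n ] ψ (+ affine (toℕ i))         ≡⟨ ℕ-Sum.sum-cong-≗ (λ i → cong (ψ ∘ +_) (sym (toℕ-affineᶠ i))) ⟩
  ℕ-Sum.∑[ i < n ] ψ (+ toℕ (π ⟨$⟩ʳ i))         ≡⟨ sym (ℕ-Sum.sum-permute (λ i → ψ (+ toℕ i)) π) ⟩
  ℕ-Sum.∑[ i < n ] ψ (+ toℕ i)                  ≡⟨ sym (sumTo≡∑ n (ψ ∘ +_)) ⟩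
  sumTo n (λ i → ψ (+ i))                       ∎
  where
  open ≡-Reasoning
  open AffinePermutation m n unit u renaming (affineᶠ-permutation to π)

addMul : ∀ {s} → ℕ → Vec ℤ s → Vec ℤ s → Vec ℤ s
addMul m []       []       = []
addMul m (a ∷ u) (b ∷ t) = a +ᶻ + m *ᶻ b ∷ addMul m u t

addMul≋ : ∀ {s} m (u t : Vec ℤ s) → addMul m u t ≋ u [mod m ]
addMul≋ m []      []      = []
addMul≋ m (a ∷ u) (b ∷ t) = mod-by b (cong (_+ᶻ_ a) (ℤₚ.*-comm (+ m) b)) ∷ addMul≋ m u t

sumCube-affine : ∀ s m n .{{_ : NonZero n}} → UnitMod m n → ∀ {F : Vec ℤ s → ℕ} → Periodic n F → ∀ u →
  sumCube s n (λ t → F (addMul m u t)) ≡ sumCube s n F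
sumCube-affine zero    m n unit per []      = refl
sumCube-affine (suc s) m n unit {F} per (a ∷ u) = begin
  sumTo n (λ i → sumCube s n (λ t → F (a +ᶻ + m *ᶻ + i ∷ addMul m u t)))
    ≡⟨ sumTo-cong n (λ i → sumCube-affine s m n unit (periodic-fixHead _ per) u) ⟩
  sumTo n (λ i → ψ (a +ᶻ + m *ᶻ + i))  ≡⟨ sumTo-affine m n unit (sumBox-periodicʰ (replicate s n) per) a ⟩
  sumTo n (λ i → ψ (+ i))               ∎
  where
  open ≡-Reasoning
  ψ : ℤ → ℕ
  ψ b = sumCube s n (λ t → F (b ∷ t))

-- Every residue modulo n m is written uniquely as u + m t with u < m and t < n.
sumCube-split : ∀ s n m (F : Vec ℤ s → ℕ) →
  sumCube s (n * m) F ≡ sumCube s m (λ u → sumCube s n (λ t → F (addMul m u t)))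
sumCube-split zero    n m F = refl
sumCube-split (suc s) n m F = begin
  sumTo (n * m) (λ i → sumCube s (n * m) (λ v → F (+ i ∷ v)))
    ≡⟨ sumTo-cong (n * m) (λ i → sumCube-split s n m (λ v → F (+ i ∷ v))) ⟩
  sumTo (n * m) Φ                                          ≡⟨ sumTo-blocks n m Φ ⟩
  sumTo n (λ t → sumTo m (λ u → Φ (t * m + u)))            ≡⟨ sumTo-comm n m _ ⟩
  sumTo m (λ u → sumTo n (λ t → Φ (t * m + u)))
    ≡⟨ sumTo-cong m (λ u → trans (sumTo-cong n (λ t → sumCube-cong s m (λ u′ → sumCube-cong s n (λ t′ →
         cong (λ z → F (z ∷ addMul m u′ t′)) (pos-block t u)))))
       (sumBox-comm (replicate s m) n _)) ⟩
  sumTo m (λ u → sumCube s m (λ u′ → sumTo n (λ t → sumCube s n (λ t′ →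
    F (+ u +ᶻ + m *ᶻ + t ∷ addMul m u′ t′)))))              ∎
  where
  open ≡-Reasoning
  Φ : ℕ → ℕ
  Φ i = sumCube s m (λ u′ → sumCube s n (λ t′ → F (+ i ∷ addMul m u′ t′)))
  pos-block : ∀ t u → + (t * m + u) ≡ + u +ᶻ + m *ᶻ + t
  pos-block t u = trans (ℤₚ.pos-+ (t * m) u) (trans (ℤₚ.+-comm (+ (t * m)) (+ u))
    (cong (_+ᶻ_ (+ u)) (trans (cong +_ (ℕₚ.*-comm t m)) (ℤₚ.pos-* m t))))

sumCube-* : ∀ s m n .{{_ : NonZero n}} → UnitMod m n → ∀ {g h : Vec ℤ s → ℕ} →
  Periodic m g → Periodic n h →
  sumCube s (n * m) (λ x → g x * h x) ≡ sumCube s m g * sumCube s n h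
sumCube-* s m n unit {g} {h} per-g per-h = begin
  sumCube s (n * m) (λ x → g x * h x)                                   ≡⟨ sumCube-split s n m _ ⟩
  sumCube s m (λ u → sumCube s n (λ t → g (addMul m u t) * h (addMul m u t)))
    ≡⟨ sumCube-cong s m (λ u → sumCube-cong s n (λ t → cong (_* h (addMul m u t)) (per-g (addMul≋ m u t)))) ⟩
  sumCube s m (λ u → sumCube s n (λ t → g u * h (addMul m u t)))
    ≡⟨ sumCube-cong s m (λ u → sumBox-distribˡ (replicate s n) (g u) _) ⟩
  sumCube s m (λ u → g u * sumCube s n (λ t → h (addMul m u t)))
    ≡⟨ sumCube-cong s m (λ u → trans (cong (g u *_) (sumCube-affine s m n unit per-h u)) (ℕₚ.*-comm (g u) _)) ⟩
  sumCube s m (λ u → sumCube s n h * g u)                               ≡⟨ sumBox-distribˡ (replicate s m) (sumCube s n h) g ⟩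
  sumCube s n h * sumCube s m g                                         ≡⟨ ℕₚ.*-comm (sumCube s n h) _ ⟩
  sumCube s m g * sumCube s n h                                         ∎
  where open ≡-Reasoning

-- The sieve by squares of small primes

mod-^ℤ : ∀ {n a b} e → a ≡ b [mod n ] → a ^ℤ e ≡ b ^ℤ e [mod n ]
mod-^ℤ zero    eq = mod-refl (+ 1)
mod-^ℤ (suc e) eq = mod-* eq (mod-^ℤ e eq)

mod-monomial : ∀ {s n} (e : Vec ℕ s) {x y} → x ≋ y [mod n ] → monomial e x ≡ monomial e y [mod n ]
mod-monomial []       []         = mod-refl (+ 1)
mod-monomial (e ∷ es) (eq ∷ eqs) = mod-* (mod-^ℤ e eq) (mod-monomial es eqs)

mod-eval : ∀ {s n} (P : Poly s) {x y} → x ≋ y [mod n ] → eval P x ≡ eval P y [mod n ]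
mod-eval []            eq = mod-refl (+ 0)
mod-eval ((c , e) ∷ P) eq = mod-+ (mod-* (mod-refl c) (mod-monomial e eq)) (mod-eval P eq)

mod-∣ : ∀ {d a b} → a ≡ b [mod d ] → d ∣ ∣ b ∣ → d ∣ ∣ a ∣
mod-∣ {d} {b = b} (mod-by k refl) d∣b =
  ℤ∣.∣⇒∣ᵤ (ℤ∣.∣m∣n⇒∣m+n (ℤ∣.∣ᵤ⇒∣ {+ d} {b} d∣b) (ℤ∣.∣n⇒∣m*n k (ℤ∣.∣-refl {+ d})))

notDvd : ℕ → ℤ → ℕ
notDvd d z = if does (d ∣? ∣ z ∣) then 0 else 1

notDvd-eval-periodic : ∀ {s} (P : Poly s) d → Periodic d (λ x → notDvd d (eval P x))
notDvd-eval-periodic P d eq = cong (λ b → if b then 0 else 1)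
  (does-⇔ (mk⇔ (mod-∣ (mod-sym (mod-eval P eq))) (mod-∣ (mod-eval P eq))) (d ∣? _) (d ∣? _))

isPrime : ℕ → Bool
isPrime k = does (prime? k)

localModulus : ℕ → ℕ
localModulus k = if isPrime k then k * k else 1

localIndicator : ∀ {s} → Poly s → ℕ → Vec ℤ s → ℕ
localIndicator P k x = if isPrime k then notDvd (k * k) (eval P x) else 1

localModulus-nonZero : ∀ k → NonZero (localModulus k)
localModulus-nonZero k with prime? k
... | yes p = ℕₚ.m*n≢0 k k {{prime⇒nonZero p}} {{prime⇒nonZero p}}
... | no _  = _

localIndicator-periodic : ∀ {s} (P : Poly s) k → Periodic (localModulus k) (localIndicator P k)
localIndicator-periodic P k with isPrime k
... | true  = notDvd-eval-periodic P (k * k)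
... | false = λ _ → refl

localModulus-unitMod : ∀ {k j} → k < j → UnitMod (localModulus j) (localModulus k)
localModulus-unitMod {k} {j} k<j with prime? k | prime? j
... | yes pk | yes pj = unitMod-*-modulus {n₁ = k} (unitMod-* j⁻¹ j⁻¹) (unitMod-* j⁻¹ j⁻¹)
  where
  j⁻¹ : UnitMod j k
  j⁻¹ = coprime⇒unitMod (Coprimality.sym (prime⇒coprime pj {{prime⇒nonZero pk}} k<j))
... | yes _  | no _   = unitMod-one (k * k)
... | no _   | _      = unitMod-modOne _

sieveModulus : List ℕ → ℕ
sieveModulus ks = product (map localModulus ks)

sieve : ∀ {s} → Poly s → List ℕ → Vec ℤ s → ℕ
sieve P ks x = product (map (λ k → localIndicator P k x) ks)

sieveModulus-nonZero : ∀ ks → NonZero (sieveModulus ks)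
sieveModulus-nonZero []       = _
sieveModulus-nonZero (k ∷ ks) =
  ℕₚ.m*n≢0 _ _ {{localModulus-nonZero k}} {{sieveModulus-nonZero ks}}

sieveModulus-unitMod : ∀ {k ks} → All (k <_) ks → UnitMod (sieveModulus ks) (localModulus k)
sieveModulus-unitMod []           = unitMod-one _
sieveModulus-unitMod (k<j ∷ k<ks) = unitMod-* (localModulus-unitMod k<j) (sieveModulus-unitMod k<ks)

sieve-periodic : ∀ {s} (P : Poly s) ks → Periodic (sieveModulus ks) (sieve P ks)
sieve-periodic P []       _  = refl
sieve-periodic P (k ∷ ks) eq = cong₂ _*_
  (periodic-multipleʳ {n = sieveModulus ks} (localIndicator-periodic P k) eq)
  (periodic-multipleˡ {m = localModulus k} (sieve-periodic P ks) eq)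

localCount : ∀ {s} → Poly s → ℕ → ℕ
localCount {s} P k = sumCube s (localModulus k) (localIndicator P k)

sieve-sum : ∀ {s} (P : Poly s) {ks} → AllPairs _<_ ks →
  sumCube s (sieveModulus ks) (sieve P ks) ≡ product (map (localCount P) ks)
sieve-sum {s} P {[]}     []             = sumCube-one s 1
sieve-sum {s} P {k ∷ ks} (k<ks ∷ sorted) = begin
  sumCube s (localModulus k * sieveModulus ks) (λ x → localIndicator P k x * sieve P ks x)
    ≡⟨ sumCube-cong s _ (λ x → ℕₚ.*-comm (localIndicator P k x) _) ⟩
  sumCube s (localModulus k * sieveModulus ks) (λ x → sieve P ks x * localIndicator P k x)
    ≡⟨ sumCube-* s (sieveModulus ks) (localModulus k) {{localModulus-nonZero k}}
         (sieveModulus-unitMod k<ks) (sieve-periodic P ks) (localIndicator-periodic P k) ⟩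
  sumCube s (sieveModulus ks) (sieve P ks) * localCount P k
    ≡⟨ ℕₚ.*-comm _ (localCount P k) ⟩
  localCount P k * sumCube s (sieveModulus ks) (sieve P ks)
    ≡⟨ cong (localCount P k *_) (sieve-sum P sorted) ⟩
  localCount P k * product (map (localCount P) ks) ∎
  where open ≡-Reasoning

μ²≤1 : ∀ z → μ² z ≤ 1
μ²≤1 z with isSquarefree ∣ z ∣
... | true  = ℕₚ.≤-refl
... | false = z≤n

allL-false : ∀ p {l} → Any (λ k → p k ≡ false) l → allL p l ≡ false
allL-false p (here pk≡false) rewrite pk≡false = refl
allL-false p {k ∷ _} (there any) = trans (cong (p k ∧_) (allL-false p any)) (∧-zeroʳ (p k))

isSquarefree-square∣ : ∀ {n k} → 2 ≤ k → k * k ∣ n → isSquarefree n ≡ false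
isSquarefree-square∣ {zero}                _               _    = refl
isSquarefree-square∣ {suc n} {suc (suc j)} (s≤s (s≤s z≤n)) kk∣n =
  allL-false _ (applyUpTo⁺ (λ i → i) witness j<1+n)
  where
  kk≤1+n : suc (suc j) * suc (suc j) ≤ suc n
  kk≤1+n = ∣⇒≤ kk∣n
  j<1+n : j < suc n
  j<1+n = ℕₚ.≤-trans (ℕₚ.n≤1+n (suc j)) (ℕₚ.≤-trans (ℕₚ.m≤m*n (suc (suc j)) (suc (suc j))) kk≤1+n)
  witness : not (does (((j + 2) * (j + 2)) ∣? suc n)) ≡ false
  witness rewrite ℕₚ.+-comm j 2 = cong not (dec-true (_ ∣? suc n) kk∣n)

μ²≤localIndicator : ∀ {s} (P : Poly s) k x → μ² (eval P x) ≤ localIndicator P k x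
μ²≤localIndicator P k x with prime? k
... | no _ = μ²≤1 (eval P x)
... | yes p with (k * k) ∣? ∣ eval P x ∣
...   | no _    = μ²≤1 (eval P x)
...   | yes kk∣ rewrite isSquarefree-square∣ (ℕ.nonTrivial⇒n>1 k {{prime⇒nonTrivial p}}) kk∣ = z≤n

μ²≤sieve : ∀ {s} (P : Poly s) ks x → μ² (eval P x) ≤ sieve P ks x
μ²≤sieve P []       x = μ²≤1 (eval P x)
μ²≤sieve P (k ∷ ks) x = ≤1⇒≤* (μ²≤1 (eval P x)) (μ²≤localIndicator P k x) (μ²≤sieve P ks x)

range : ℕ → List ℤ
range d = map +_ (upTo d)

sumOver-vecs-range : ∀ s d F → sumOver (vecs s (range d)) F ≡ sumCube s d F
sumOver-vecs-range zero    d F = ℕₚ.+-identityʳ (F [])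
sumOver-vecs-range (suc s) d F = begin
  sumOver (vecs (suc s) (range d)) F                                  ≡⟨ sumOver-grid (range d) _ F ⟩
  sumOver (range d) (λ a → sumOver (vecs s (range d)) (λ v → F (a ∷ v)))
    ≡⟨ sumOver-cong (range d) (λ a → sumOver-vecs-range s d (λ v → F (a ∷ v))) ⟩
  sumOver (range d) (λ a → sumCube s d (λ v → F (a ∷ v)))             ≡⟨ sumOver-map +_ (upTo d) _ ⟩
  sumOver (upTo d) (λ i → sumCube s d (λ v → F (+ i ∷ v)))            ≡⟨ sumOver-applyUpTo d (λ i → i) _ ⟩
  sumCube (suc s) d F                                                 ∎
  where open ≡-Reasoning

sumCube-notDvd+ρ : ∀ {s} (P : Poly s) d → sumCube s d (λ x → notDvd d (eval P x)) + ρ P d ≡ d ^ s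
sumCube-notDvd+ρ {s} P d = begin
  sumCube s d (λ x → notDvd d (eval P x)) + ρ P d
    ≡⟨ cong (_+ ρ P d) (sym (sumOver-vecs-range s d _)) ⟩
  sumOver (vecs s (range d)) (λ x → notDvd d (eval P x)) + ρ P d
    ≡⟨ sumOver-rejected+length-filter (λ x → d ∣? ∣ eval P x ∣) (vecs s (range d)) ⟩
  length (vecs s (range d))       ≡⟨ length-vecs s (range d) ⟩
  length (range d) ^ s            ≡⟨ cong (_^ s) (trans (Listₚ.length-map +_ (upTo d)) (Listₚ.length-upTo d)) ⟩
  d ^ s                           ∎
  where open ≡-Reasoning

-- Periodic sums over a box

sumOver-interval : ∀ P φ → sumOver (interval P) φ ≡
  sumTo (suc P) (λ i → φ (+ i)) + sumTo P (λ i → φ (-ᶻ + suc i))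
sumOver-interval P φ = trans (sumOver-++ (map +_ (upTo (suc P))) _ φ)
  (cong₂ _+_ (trans (sumOver-map +_ (upTo (suc P)) φ) (sumOver-applyUpTo (suc P) (λ i → i) _))
             (trans (sumOver-map _ (upTo P) φ) (sumOver-applyUpTo P (λ i → i) _)))

-- [-P, P] is covered by k periods on each side of 0, and i ↦ m − 1 − i maps the negative
-- representatives −1, …, −m of a period onto 0, …, m − 1.
sumOver-interval-periodic : ∀ m {φ} → Periodic₁ m φ → ∀ k P → suc P ≤ k * m →
  sumOver (interval P) φ ≤ (k + k) * sumTo m (λ i → φ (+ i))
sumOver-interval-periodic m {φ} per k P 1+P≤km = begin
  sumOver (interval P) φ                                  ≡⟨ sumOver-interval P φ ⟩
  sumTo (suc P) (λ i → φ (+ i)) + sumTo P negative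
    ≤⟨ ℕₚ.+-mono-≤ (sumTo-mono-length _ 1+P≤km) (sumTo-mono-length _ (ℕₚ.≤-trans (ℕₚ.n≤1+n P) 1+P≤km)) ⟩
  sumTo (k * m) (λ i → φ (+ i)) + sumTo (k * m) negative
    ≡⟨ cong₂ _+_ (sumTo-periodic k m _ positive-period) (sumTo-periodic k m _ negative-period) ⟩
  k * S + k * sumTo m negative                            ≡⟨ cong (λ z → k * S + k * z) negative≡positive ⟩
  k * S + k * S                                           ≡⟨ sym (ℕₚ.*-distribʳ-+ S k k) ⟩
  (k + k) * S                                             ∎
  where
  open ℕₚ.≤-Reasoning
  S = sumTo m (λ i → φ (+ i))
  negative : ℕ → ℕ
  negative i = φ (-ᶻ + suc i)
  positive-period : ∀ i → φ (+ (i + m)) ≡ φ (+ i)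
  positive-period i = per (mod-by (+ 1) (trans (ℤₚ.pos-+ i m) (lemma (+ i) (+ m))))
    where lemma : ∀ i m → i +ᶻ m ≡ i +ᶻ + 1 *ᶻ m
          lemma = solve-∀
  negative-period : ∀ i → negative (i + m) ≡ negative i
  negative-period i = per (mod-by (-ᶻ + 1)
    (trans (cong (λ z → -ᶻ (+ 1 +ᶻ z)) (ℤₚ.pos-+ i m)) (lemma (+ i) (+ m))))
    where lemma : ∀ i m → -ᶻ (+ 1 +ᶻ (i +ᶻ m)) ≡ -ᶻ (+ 1 +ᶻ i) +ᶻ (-ᶻ + 1) *ᶻ m
          lemma = solve-∀
  reflect : ∀ i → i < m → negative i ≡ φ (+ (m ∸ suc i))
  reflect i i<m = per (mod-by (-ᶻ + 1) (trans (lemma (+ i) (+ m))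
    (cong (λ z → z +ᶻ (-ᶻ + 1) *ᶻ + m) (trans (ℤₚ.m-n≡m⊖n m (suc i)) (ℤₚ.⊖-≥ i<m)))))
    where lemma : ∀ i m → -ᶻ (+ 1 +ᶻ i) ≡ (m -ᶻ (+ 1 +ᶻ i)) +ᶻ (-ᶻ + 1) *ᶻ m
          lemma = solve-∀
  negative≡positive : sumTo m negative ≡ S
  negative≡positive = trans (sumTo-cong-< m reflect) (sumTo-reverse m (λ i → φ (+ i)))

blocks : ℕ → (m : ℕ) → .{{_ : NonZero m}} → ℕ
blocks P m = suc (P / m)

blocks-cover : ∀ P m .{{_ : NonZero m}} → suc P ≤ blocks P m * m
blocks-cover P m = subst (λ z → suc z ≤ m + P / m * m) (sym (ℕ/.m≡m%n+[m/n]*n P m))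
  (ℕₚ.+-monoˡ-≤ (P / m * m) (ℕ/.m%n<n P m))

blocks-tight : ∀ P m .{{_ : NonZero m}} → m ≤ P → (blocks P m + blocks P m) * m ≤ 4 * P
blocks-tight P m m≤P = begin
  (k + k) * m                 ≡⟨ ℕₚ.*-distribʳ-+ m k k ⟩
  k * m + k * m               ≤⟨ ℕₚ.+-mono-≤ km≤2P km≤2P ⟩
  (P + P) + (P + P)           ≡⟨ lemma P ⟩
  4 * P                       ∎
  where
  open ℕₚ.≤-Reasoning
  k = blocks P m
  km≤2P : k * m ≤ P + P
  km≤2P = ℕₚ.+-mono-≤ m≤P (ℕ/.m/n*n≤m P m)
  lemma : ∀ P → (P + P) + (P + P) ≡ 4 * P
  lemma = ℕ-Solver.solve-∀

boxBlocks : ∀ {s} → Vec ℕ s → (m : ℕ) → .{{_ : NonZero m}} → ℕ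
boxBlocks []       m = 1
boxBlocks (P ∷ Ps) m = (blocks P m + blocks P m) * boxBlocks Ps m

sumOver-box-periodic : ∀ {s} m .{{_ : NonZero m}} (Ps : Vec ℕ s) {F : Vec ℤ s → ℕ} → Periodic m F →
  sumOver (box Ps) F ≤ boxBlocks Ps m * sumCube s m F
sumOver-box-periodic m []       per = ℕₚ.≤-refl
sumOver-box-periodic {suc s} m (P ∷ Ps) {F} per = begin
  sumOver (box (P ∷ Ps)) F                          ≡⟨ sumOver-grid (interval P) (box Ps) F ⟩
  sumOver (interval P) (λ a → sumOver (box Ps) (λ v → F (a ∷ v)))
    ≤⟨ sumOver-mono (interval P) (λ a → sumOver-box-periodic m Ps (periodic-fixHead a per)) ⟩
  sumOver (interval P) (λ a → C * ψ a)              ≡⟨ sumOver-distribˡ (interval P) C ψ ⟩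
  C * sumOver (interval P) ψ
    ≤⟨ ℕₚ.*-monoʳ-≤ C (sumOver-interval-periodic m (sumBox-periodicʰ (replicate s m) per)
                         (blocks P m) P (blocks-cover P m)) ⟩
  C * ((k + k) * sumCube (suc s) m F)               ≡⟨ lemma C (k + k) _ ⟩
  (k + k) * C * sumCube (suc s) m F                 ∎
  where
  open ℕₚ.≤-Reasoning
  C = boxBlocks Ps m
  k = blocks P m
  ψ : ℤ → ℕ
  ψ a = sumCube s m (λ v → F (a ∷ v))
  lemma : ∀ c b x → c * (b * x) ≡ b * c * x
  lemma = ℕ-Solver.solve-∀

boxBlocks-volume : ∀ {s} m .{{_ : NonZero m}} (Ps : Vec ℕ s) → AllAtLeast m Ps →
  boxBlocks Ps m * m ^ s ≤ 4 ^ s * prodVec Ps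
boxBlocks-volume m []       Vec.[]           = ℕₚ.≤-refl
boxBlocks-volume {suc s} m (P ∷ Ps) (m≤P Vec.∷ m≤Ps) = begin
  (k + k) * C * (m * m ^ s)              ≡⟨ regroup (k + k) C m (m ^ s) ⟩
  ((k + k) * m) * (C * m ^ s)            ≤⟨ ℕₚ.*-mono-≤ (blocks-tight P m m≤P) (boxBlocks-volume m Ps m≤Ps) ⟩
  (4 * P) * (4 ^ s * prodVec Ps)         ≡⟨ regroup 4 P (4 ^ s) (prodVec Ps) ⟩
  4 * 4 ^ s * (P * prodVec Ps)           ∎
  where
  open ℕₚ.≤-Reasoning
  k = blocks P m
  C = boxBlocks Ps m
  regroup : ∀ a b c d → a * b * (c * d) ≡ (a * c) * (b * d)
  regroup = ℕ-Solver.solve-∀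

toℚ : ℕ → ℚ
toℚ a = + a ℚ./ 1

toℚᵘ-toℚ : ∀ a → ℚ.toℚᵘ (toℚ a) ℚᵘ.≃ mkℚᵘ (+ a) 0
toℚᵘ-toℚ a = ℚₚ.toℚᵘ-fromℚᵘ (mkℚᵘ (+ a) 0)

toℚ-* : ∀ a b → toℚ (a * b) ≡ toℚ a ℚ.* toℚ b
toℚ-* a b = ℚₚ.toℚᵘ-injective (ℚᵘₚ.≃-trans (toℚᵘ-toℚ (a * b))
  (ℚᵘₚ.≃-trans (*≡* (cong (ℤ._* + 1) (ℤₚ.pos-* a b)))
  (ℚᵘₚ.≃-sym (ℚᵘₚ.≃-trans (ℚₚ.toℚᵘ-homo-* (toℚ a) (toℚ b)) (ℚᵘₚ.*-cong (toℚᵘ-toℚ a) (toℚᵘ-toℚ b))))))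

toℚ-+ : ∀ a b → toℚ (a + b) ≡ toℚ a ℚ.+ toℚ b
toℚ-+ a b = ℚₚ.toℚᵘ-injective (ℚᵘₚ.≃-trans (toℚᵘ-toℚ (a + b))
  (ℚᵘₚ.≃-trans (*≡* (cong (ℤ._* + 1) (trans (ℤₚ.pos-+ a b)
       (sym (cong₂ _+ᶻ_ (ℤₚ.*-identityʳ (+ a)) (ℤₚ.*-identityʳ (+ b)))))))
  (ℚᵘₚ.≃-sym (ℚᵘₚ.≃-trans (ℚₚ.toℚᵘ-homo-+ (toℚ a) (toℚ b)) (ℚᵘₚ.+-cong (toℚᵘ-toℚ a) (toℚᵘ-toℚ b))))))

toℚ-mono-≤ : ∀ {a b} → a ≤ b → toℚ a ℚ.≤ toℚ b
toℚ-mono-≤ {a} {b} a≤b = ℚₚ.toℚᵘ-cancel-≤ (ℚᵘₚ.≤-trans (ℚᵘₚ.≤-reflexive (toℚᵘ-toℚ a))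
  (ℚᵘₚ.≤-trans (*≤* (ℤₚ.*-monoʳ-≤-nonNeg (+ 1) (ℤ.+≤+ a≤b))) (ℚᵘₚ.≤-reflexive (ℚᵘₚ.≃-sym (toℚᵘ-toℚ b)))))

/-*-toℚ : ∀ i d .{{_ : NonZero d}} → (i ℚ./ d) ℚ.* toℚ d ≡ i ℚ./ 1
/-*-toℚ i (suc d) = ℚₚ.toℚᵘ-injective (ℚᵘₚ.≃-trans (ℚₚ.toℚᵘ-homo-* (i ℚ./ suc d) (toℚ (suc d)))
  (ℚᵘₚ.≃-trans (ℚᵘₚ.*-cong (ℚₚ.toℚᵘ-fromℚᵘ (mkℚᵘ i d)) (toℚᵘ-toℚ (suc d)))
  (ℚᵘₚ.≃-trans (*≡* cross) (ℚᵘₚ.≃-sym (ℚₚ.toℚᵘ-fromℚᵘ (mkℚᵘ i 0))))))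
  where
  cross : (i ℤ.* + suc d) ℤ.* + 1 ≡ i ℤ.* + (suc d * 1)
  cross = trans (ℤₚ.*-identityʳ _) (cong (λ z → i ℤ.* + z) (sym (ℕₚ.*-identityʳ (suc d))))

open +-*-Solver using (con; _:+_; _:*_; _:-_; _:=_) renaming (solve to solveℚ)

1-/-*-toℚ : ∀ r d .{{_ : NonZero d}} → r ≤ d → (1ℚ ℚ.- (+ r ℚ./ d)) ℚ.* toℚ d ≡ toℚ (d ∸ r)
1-/-*-toℚ r d r≤d = begin
  (1ℚ ℚ.- x) ℚ.* toℚ d                    ≡⟨ solveℚ 2 (λ x y → (con 1ℚ :- x) :* y := y :- x :* y) refl x (toℚ d) ⟩
  toℚ d ℚ.- x ℚ.* toℚ d                   ≡⟨ cong (ℚ._-_ (toℚ d)) (/-*-toℚ (+ r) d) ⟩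
  toℚ d ℚ.- toℚ r                         ≡⟨ cong (ℚ._- toℚ r) (trans (cong toℚ (sym (ℕₚ.m∸n+n≡m r≤d))) (toℚ-+ (d ∸ r) r)) ⟩
  (toℚ (d ∸ r) ℚ.+ toℚ r) ℚ.- toℚ r       ≡⟨ solveℚ 2 (λ a b → (a :+ b) :- b := a) refl (toℚ (d ∸ r)) (toℚ r) ⟩
  toℚ (d ∸ r)                             ∎
  where
  open ≡-Reasoning
  x = + r ℚ./ d

trivialFactor-count : ∀ s → 1ℚ ℚ.* toℚ (1 ^ s) ≡ toℚ (sumCube s 1 (λ _ → 1))
trivialFactor-count s = trans (ℚₚ.*-identityˡ _) (cong toℚ (trans (ℕₚ.^-zeroˡ s) (sym (sumCube-one s 1))))

localFactor-localCount : ∀ {s} (P : Poly s) k → localFactor P k ℚ.* toℚ (localModulus k ^ s) ≡ toℚ (localCount P k)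
localFactor-localCount {s} P zero with prime? 0
... | yes p = ⊥-elim (¬prime[0] p)
... | no _  = trivialFactor-count s
localFactor-localCount {s} P (suc k) with prime? (suc k)
... | no _  = trivialFactor-count s
... | yes _ = begin
  (1ℚ ℚ.- (+ ρ P p² ℚ./ p ^ (2 * s)) {{p^2s≢0}}) ℚ.* toℚ (p² ^ s)
    ≡⟨ cong (λ z → (1ℚ ℚ.- (+ ρ P p² ℚ./ p ^ (2 * s)) {{p^2s≢0}}) ℚ.* toℚ z) (sym p^2s≡p²^s) ⟩
  (1ℚ ℚ.- (+ ρ P p² ℚ./ p ^ (2 * s)) {{p^2s≢0}}) ℚ.* toℚ (p ^ (2 * s))
    ≡⟨ 1-/-*-toℚ (ρ P p²) (p ^ (2 * s)) {{p^2s≢0}} ρ≤p^2s ⟩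
  toℚ (p ^ (2 * s) ∸ ρ P p²)
    ≡⟨ cong toℚ (trans (cong (_∸ ρ P p²) (trans p^2s≡p²^s (sym (sumCube-notDvd+ρ P p²))))
                       (ℕₚ.m+n∸n≡m _ (ρ P p²))) ⟩
  toℚ (sumCube s p² (λ x → notDvd p² (eval P x)))  ∎
  where
  open ≡-Reasoning
  p = suc k
  p² = p * p
  p^2s≢0 = ℕₚ.m^n≢0 p (2 * s)
  p^2s≡p²^s : p ^ (2 * s) ≡ p² ^ s
  p^2s≡p²^s = trans (sym (ℕₚ.^-*-assoc p 2 s)) (cong (λ z → (p * z) ^ s) (ℕₚ.*-identityʳ p))
  ρ≤p^2s : ρ P p² ≤ p ^ (2 * s)
  ρ≤p^2s = subst (ρ P p² ≤_) (trans (sumCube-notDvd+ρ P p²) (sym p^2s≡p²^s)) (ℕₚ.m≤n+m (ρ P p²) _)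

partialProduct-count : ∀ {s} (P : Poly s) ks →
  foldr ℚ._*_ 1ℚ (map (localFactor P) ks) ℚ.* toℚ (sieveModulus ks ^ s) ≡
  toℚ (product (map (localCount P) ks))
partialProduct-count {s} P []       = trans (ℚₚ.*-identityˡ _) (cong toℚ (ℕₚ.^-zeroˡ s))
partialProduct-count {s} P (k ∷ ks) = begin
  (localFactor P k ℚ.* Π) ℚ.* toℚ ((localModulus k * M) ^ s)
    ≡⟨ cong ((localFactor P k ℚ.* Π) ℚ.*_)
         (trans (cong toℚ (^-distribʳ-* s (localModulus k) M)) (toℚ-* (localModulus k ^ s) (M ^ s))) ⟩
  (localFactor P k ℚ.* Π) ℚ.* (toℚ (localModulus k ^ s) ℚ.* toℚ (M ^ s))
    ≡⟨ solveℚ 4 (λ f π a b → (f :* π) :* (a :* b) := (f :* a) :* (π :* b)) refl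
         (localFactor P k) Π (toℚ (localModulus k ^ s)) (toℚ (M ^ s)) ⟩
  (localFactor P k ℚ.* toℚ (localModulus k ^ s)) ℚ.* (Π ℚ.* toℚ (M ^ s))
    ≡⟨ cong₂ ℚ._*_ (localFactor-localCount P k) (partialProduct-count P ks) ⟩
  toℚ (localCount P k) ℚ.* toℚ (product (map (localCount P) ks))
    ≡⟨ sym (toℚ-* (localCount P k) _) ⟩
  toℚ (localCount P k * product (map (localCount P) ks)) ∎
  where
  open ≡-Reasoning
  Π = foldr ℚ._*_ 1ℚ (map (localFactor P) ks)
  M = sieveModulus ks

N-sieve-bound : ∀ {s} (P : Poly s) {ks} → AllPairs _<_ ks → ∀ (Ps : Vec ℕ s) →
  AllAtLeast (sieveModulus ks) Ps →
  N P Ps * sieveModulus ks ^ s ≤ 4 ^ s * prodVec Ps * product (map (localCount P) ks)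
N-sieve-bound {s} P {ks} sorted Ps m≤Ps = begin
  N P Ps * m ^ s                        ≤⟨ ℕₚ.*-monoˡ-≤ (m ^ s) N≤ ⟩
  boxBlocks Ps m * G * m ^ s            ≡⟨ lemma (boxBlocks Ps m) G (m ^ s) ⟩
  boxBlocks Ps m * m ^ s * G            ≤⟨ ℕₚ.*-monoˡ-≤ G (boxBlocks-volume m Ps m≤Ps) ⟩
  4 ^ s * prodVec Ps * G                ∎
  where
  open ℕₚ.≤-Reasoning
  m = sieveModulus ks
  instance
    m≢0 : NonZero m
    m≢0 = sieveModulus-nonZero ks
  G = product (map (localCount P) ks)
  N≤ : N P Ps ≤ boxBlocks Ps m * G
  N≤ = ℕₚ.≤-trans (sumOver-mono (box Ps) (μ²≤sieve P ks))
         (subst (sumOver (box Ps) (sieve P ks) ≤_) (cong (boxBlocks Ps m *_) (sieve-sum P sorted))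
           (sumOver-box-periodic m Ps (sieve-periodic P ks)))
  lemma : ∀ c g d → c * g * d ≡ c * d * g
  lemma = ℕ-Solver.solve-∀

N≤partialProd : ∀ {s} (P : Poly s) n (Ps : Vec ℕ s) → AllAtLeast (sieveModulus (upTo (suc n))) Ps →
  toℚ (N P Ps) ℚ.≤ toℚ (4 ^ s) ℚ.* toℚ (prodVec Ps) ℚ.* partialProd P n
N≤partialProd {s} P n Ps m≤Ps = ℚₚ.*-cancelʳ-≤-pos (toℚ D) {{ℚₚ.normalize-pos D 1}} (begin
  toℚ (N P Ps) ℚ.* toℚ D            ≡⟨ sym (toℚ-* (N P Ps) D) ⟩
  toℚ (N P Ps * D)                  ≤⟨ toℚ-mono-≤ (N-sieve-bound P sorted Ps m≤Ps) ⟩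
  toℚ (4 ^ s * prodVec Ps * G)      ≡⟨ trans (toℚ-* (4 ^ s * prodVec Ps) G) (cong (ℚ._* toℚ G) (toℚ-* (4 ^ s) (prodVec Ps))) ⟩
  C ℚ.* toℚ G                       ≡⟨ cong (C ℚ.*_) (sym (partialProduct-count P ks)) ⟩
  C ℚ.* (partialProd P n ℚ.* toℚ D) ≡⟨ sym (ℚₚ.*-assoc C (partialProd P n) (toℚ D)) ⟩
  C ℚ.* partialProd P n ℚ.* toℚ D   ∎)
  where
  open ℚₚ.≤-Reasoning
  ks = upTo (suc n)
  sorted : AllPairs _<_ ks
  sorted = AllPairs.applyUpTo⁺₁ (λ i → i) (suc n) (λ i<j _ → i<j)
  m = sieveModulus ks
  instance
    m≢0 : NonZero m
    m≢0 = sieveModulus-nonZero ks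
    D≢0 : NonZero (m ^ s)
    D≢0 = ℕₚ.m^n≢0 m s
  D = m ^ s
  G = product (map (localCount P) ks)
  C = toℚ (4 ^ s) ℚ.* toℚ (prodVec Ps)

theorem1p3 : (s : ℕ) → 2 ≤ s → (P : Poly s) → SingularSeriesZero P →
    ∀ (ε : ℚ) → 0ℚ ℚ.< ε → ∃ λ M → ∀ (Ps : Vec ℕ s) → AllAtLeast (ℕ.suc M) Ps →
      (+ N P Ps) ℚ./ 1 ℚ.≤ ε ℚ.* ((+ prodVec Ps) ℚ./ 1)
theorem1p3 s _ P 𝔖≡0 ε ε>0 =
  let n , Π<εc = 𝔖≡0 (ε ℚ.* c) εc>0 in
  sieveModulus (upTo (suc n)) , λ Ps m<Ps → begin
    toℚ (N P Ps)                                      ≤⟨ N≤partialProd P n Ps (Vec.map ℕₚ.<⇒≤ m<Ps) ⟩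
    toℚ (4 ^ s) ℚ.* toℚ (prodVec Ps) ℚ.* partialProd P n
      ≤⟨ ℚₚ.*-monoˡ-≤-nonNeg (toℚ (4 ^ s) ℚ.* toℚ (prodVec Ps))
           {{ℚₚ.nonNeg*nonNeg⇒nonNeg (toℚ (4 ^ s)) {{toℚ-nonNeg (4 ^ s)}} (toℚ (prodVec Ps)) {{toℚ-nonNeg (prodVec Ps)}}}}
           (ℚₚ.<⇒≤ Π<εc) ⟩
    toℚ (4 ^ s) ℚ.* toℚ (prodVec Ps) ℚ.* (ε ℚ.* c)
      ≡⟨ solveℚ 4 (λ w p e c → w :* p :* (e :* c) := (c :* w) :* (e :* p)) refl (toℚ (4 ^ s)) (toℚ (prodVec Ps)) ε c ⟩
    (c ℚ.* toℚ (4 ^ s)) ℚ.* (ε ℚ.* toℚ (prodVec Ps))  ≡⟨ cong (ℚ._* (ε ℚ.* toℚ (prodVec Ps))) (/-*-toℚ (+ 1) (4 ^ s)) ⟩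
    1ℚ ℚ.* (ε ℚ.* toℚ (prodVec Ps))                   ≡⟨ ℚₚ.*-identityˡ _ ⟩
    ε ℚ.* toℚ (prodVec Ps)                            ∎
  where
  open ℚₚ.≤-Reasoning
  instance
    4^s≢0 : NonZero (4 ^ s)
    4^s≢0 = ℕₚ.m^n≢0 4 s
  c = + 1 ℚ./ 4 ^ s
  εc>0 : 0ℚ ℚ.< ε ℚ.* c
  εc>0 = ℚₚ.positive⁻¹ _ {{ℚₚ.pos*pos⇒pos ε {{ℚ.positive ε>0}} c {{ℚₚ.normalize-pos 1 (4 ^ s)}}}}
  toℚ-nonNeg : ∀ a → ℚ.NonNegative (toℚ a)
  toℚ-nonNeg a = ℚₚ.normalize-nonNeg a 1
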